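{- Let $\alpha(k)$ be the largest odd divisor of $k$, $G(n)=\sum_{k=1}^n\frac{n+1-k}{k}\alpha(k)$ and $g(n)=\frac{n(n+2)}{3}-G(n)$. For $r\ge0$ let $x_r=\frac23(2^{2r}-1)$ and $y_r=2x_r$. For every integer $m\ge2$, the function $g$ restricted to $\{t: 2^m\le t<2^{m+1}\}$ attains its maximum at exactly two points, namely $$2^m+x_{\lfloor m/2\rfloor}\quad\text{and}\quad 2^m+y_{\lfloor (m-1)/2\rfloor}.$$
   Context: $\alpha(k)$ is the largest odd divisor of the positive integer $k$; $\lfloor\cdot\rfloor$ is the floor function. -}

module Defs where

open import Data.Nat as ℕ using (ℕ; zero; suc; _∸_; _^_)
open import Data.Nat.Divisibility using (_∣?_)
open import Data.Nat.Base using (_%_; _/_)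
open import Data.Integer using (+_)
open import Data.Rational as ℚ using (ℚ; 0ℚ)
open import Relation.Nullary.Decidable using (does)
open import Data.Bool using (if_then_else_; _∧_)
open import Data.Nat using (_≡ᵇ_)

oddDivSearch : ℕ → ℕ → ℕ
oddDivSearch zero    k = 0
oddDivSearch (suc d) k =
  if does (suc d ∣? k) ∧ (suc d % 2 ≡ᵇ 1) then suc d else oddDivSearch d k

α : ℕ → ℕ
α k = oddDivSearch k k

Gterm : ℕ → ℕ → ℚ
Gterm n i = ((+ (suc n ∸ suc i)) ℚ./ suc i) ℚ.* ((+ α (suc i)) ℚ./ 1)

-- sum_{i < j} Gterm n i, i.e. sum over k = 1..j
Gsum : ℕ → ℕ → ℚ
Gsum n zero    = 0ℚ
Gsum n (suc j) = Gsum n j ℚ.+ Gterm n j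

G : ℕ → ℚ
G n = Gsum n n

g : ℕ → ℚ
g n = ((+ (n ℕ.* (n ℕ.+ 2))) ℚ./ 3) ℚ.- G n

-- x_r = (2/3)(2^{2r} - 1)  (always a natural number; division exact)
x : ℕ → ℕ
x r = (2 ℕ.* (2 ^ (2 ℕ.* r) ∸ 1)) / 3

y : ℕ → ℕ
y r = 2 ℕ.* x r

module Submission where

-- With Σα/k n = Σ_{k ≤ n} α(k)/k and ΣΣα/k n = Σ_{j < n} Σα/k j one has G n = ΣΣα/k (n + 1), so
-- g n = (U (n + 1) − 1)/3 for U N = N² − 3·ΣΣα/k N. Since α(2k) = α(k) and α(2k+1) = 2k+1,
-- U(2q) = U(q) and U(2q+1) = (1 + U(q) + U(q+1))/2.
-- On [4h, 8h] an even point repeats a value of U on [2h, 4h], while U(4b+1) and U(4b+3) are such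
-- means of a value on [h, 2h] and a value on [2h, 4h]. So if the maxima satisfy M_h ≤ M_2h < 1 + M_h,
-- then M_4h = (1 + M_h + M_2h)/2 exceeds M_2h, it is attained only at the two odd points built from
-- the maximisers of the two smaller blocks, and the invariant propagates. Starting from [2, 4] and
-- [4, 8], every block has exactly two maximisers; solving their recurrence gives the closed forms
-- 2^m + x_⌊m/2⌋ and 2^m + y_⌊(m−1)/2⌋ (as maximisers of g, one less than those of U).

open import Defs
open import Data.Nat using (ℕ; zero; suc; _+_; _*_; _∸_; _^_; _≤_; _<_; _/_; _%_; _≡ᵇ_; z≤n; s≤s)
open import Data.Nat.Properties as ℕ
  using (suc-injective; +-suc; +-identityʳ; ≤-trans; n≤1+n; <⇒≤; m≤n+m; ≡ᵇ⇒≡)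
open import Data.Nat.DivMod using (m*n/n≡m; m/n≡1+[m∸n]/n)
open import Data.Nat.Divisibility using (_∣_; _∣?_; ∣-refl; >⇒∤; ∣m∣n⇒∣m+n)
open import Data.Nat.Coprimality using (Coprime; 1-coprimeTo; coprime-+; coprime-divisor)
open import Data.Nat.Tactic.RingSolver using (solve-∀)
open import Data.Integer as ℤ using (ℤ; +_)
import Data.Integer.Properties as ℤ
open import Data.Rational as ℚ using (ℚ; 0ℚ; 1ℚ; ½)
open import Data.Rational using () renaming (_≤_ to _≤ℚ_)
import Data.Rational.Properties as ℚ
open import Data.Rational.Solver renaming (module +-*-Solver to ℚ-Solver)
import Data.Rational.Unnormalised as ℚᵘ
import Data.Rational.Unnormalised.Properties as ℚᵘ
open import Data.Bool using (T; true; false; _∧_)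
open import Data.Bool.Properties using (∧-zeroʳ; ∧-identityʳ)
open import Data.Empty using (⊥; ⊥-elim)
open import Data.Product using (Σ; _×_; _,_; proj₁; proj₂)
open import Data.Sum as Sum using (_⊎_; inj₁; inj₂)
open import Function using (_∘_)
open import Function.Bundles using (_⇔_; mk⇔; Equivalence)
open import Relation.Binary.Definitions using (tri<; tri≈; tri>)
open import Relation.Binary.PropositionalEquality
open import Relation.Nullary using (Dec; yes; no)
open import Relation.Nullary.Decidable
  using (does; dec-true; dec-false; True; False; toWitness; toWitnessFalse; from-yes)

open ℚ-Solver using (solve; _:+_; _:*_; _:-_; _:=_; con)

-- Doubling and dyadic blocks

double : ℕ → ℕ
double zero    = zero
double (suc n) = suc (suc (double n))

double≡+ : ∀ n → double n ≡ n + n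
double≡+ zero    = refl
double≡+ (suc n) = cong suc (trans (cong suc (double≡+ n)) (sym (+-suc n n)))

double≡2* : ∀ n → double n ≡ 2 * n
double≡2* n = trans (double≡+ n) (cong (_+_ n) (sym (+-identityʳ n)))

double-injective : ∀ {a b} → double a ≡ double b → a ≡ b
double-injective {zero}  {zero}  _ = refl
double-injective {suc a} {suc b} e = cong suc (double-injective (suc-injective (suc-injective e)))

odd-injective : ∀ {a b} → suc (double a) ≡ suc (double b) → a ≡ b
odd-injective = double-injective ∘ suc-injective

double≢odd : ∀ {a b} → double a ≢ suc (double b)
double≢odd {suc a} {suc b} e = double≢odd (suc-injective (suc-injective e))

double-mono-≤ : ∀ {a b} → a ≤ b → double a ≤ double b
double-mono-≤ z≤n     = z≤n
double-mono-≤ (s≤s p) = s≤s (s≤s (double-mono-≤ p))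

double-cancel-≤ : ∀ {a b} → double a ≤ double b → a ≤ b
double-cancel-≤ {zero}          _             = z≤n
double-cancel-≤ {suc a} {suc b} (s≤s (s≤s p)) = s≤s (double-cancel-≤ p)

double≤odd⇒≤ : ∀ {a b} → double a ≤ suc (double b) → a ≤ b
double≤odd⇒≤ {zero}          _             = z≤n
double≤odd⇒≤ {suc a} {suc b} (s≤s (s≤s p)) = s≤s (double≤odd⇒≤ p)

odd≤double⇒< : ∀ {a b} → suc (double a) ≤ double b → a < b
odd≤double⇒< {zero}  {suc b} _             = s≤s z≤n
odd≤double⇒< {suc a} {suc b} (s≤s (s≤s p)) = s≤s (odd≤double⇒< p)

data Mod4 : ℕ → Set where
  2c   : ∀ c → Mod4 (double c)
  4b+1 : ∀ b → Mod4 (suc (double (double b)))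
  4b+3 : ∀ b → Mod4 (suc (double (suc (double b))))

mod4 : ∀ n → Mod4 n
mod4 zero          = 2c zero
mod4 (suc zero)    = 4b+1 zero
mod4 (suc (suc n)) with mod4 n
... | 2c c   = 2c (suc c)
... | 4b+1 b = 4b+3 b
... | 4b+3 b = 4b+1 (suc b)

pow2 : ℕ → ℕ
pow2 zero    = 1
pow2 (suc n) = double (pow2 n)

pow2≡2^ : ∀ n → pow2 n ≡ 2 ^ n
pow2≡2^ zero    = refl
pow2≡2^ (suc n) = trans (double≡2* (pow2 n)) (cong (2 *_) (pow2≡2^ n))

_∈⟦_⟧ : ℕ → ℕ → Set
n ∈⟦ h ⟧ = h ≤ n × n ≤ double h

∈⟦⟧-elim : ∀ (P : ℕ → Set) h → (∀ i → i ≤ h → P (h + i)) → ∀ {n} → n ∈⟦ h ⟧ → P n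
∈⟦⟧-elim P h p {n} (h≤n , n≤2h) = subst P (ℕ.m+[n∸m]≡n h≤n) (p (n ∸ h) n∸h≤h)
  where
  n∸h≤h : n ∸ h ≤ h
  n∸h≤h = subst (n ∸ h ≤_) (ℕ.m+n∸m≡n h h) (ℕ.∸-monoˡ-≤ h (subst (n ≤_) (double≡+ h) n≤2h))

∈⟦⟧-double : ∀ {h c} → double c ∈⟦ double h ⟧ → c ∈⟦ h ⟧
∈⟦⟧-double (lo , hi) = double-cancel-≤ lo , double-cancel-≤ hi

∈⟦⟧-4b+1 : ∀ {h b} → suc (double (double b)) ∈⟦ double (double h) ⟧ →
           b ∈⟦ h ⟧ × suc (double b) ∈⟦ double h ⟧
∈⟦⟧-4b+1 {h} {b} (lo , hi) =
  (h≤b , <⇒≤ (odd≤double⇒< 2b+1≤4h)) , (≤-trans (double-mono-≤ h≤b) (n≤1+n _) , 2b+1≤4h)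
  where
  h≤b : h ≤ b
  h≤b = double-cancel-≤ (double≤odd⇒≤ lo)
  2b+1≤4h : suc (double b) ≤ double (double h)
  2b+1≤4h = odd≤double⇒< hi

∈⟦⟧-4b+3 : ∀ {h b} → suc (double (suc (double b))) ∈⟦ double (double h) ⟧ →
           suc b ∈⟦ h ⟧ × suc (double b) ∈⟦ double h ⟧
∈⟦⟧-4b+3 {h} {b} (lo , hi) =
  (≤-trans (double≤odd⇒≤ 2h≤2b+1) (n≤1+n _) , double-cancel-≤ 2b+2≤4h) , (2h≤2b+1 , ≤-trans (n≤1+n _) 2b+2≤4h)
  where
  2h≤2b+1 : double h ≤ suc (double b)
  2h≤2b+1 = double≤odd⇒≤ lo
  2b+2≤4h : double (suc b) ≤ double (double h)
  2b+2≤4h = odd≤double⇒< hi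

-- Maxima on dyadic blocks of functions with the recurrence of U

mean⁺ : ℚ → ℚ → ℚ
mean⁺ a b = ½ ℚ.* (1ℚ ℚ.+ (a ℚ.+ b))

mean⁺-mono-≤ : ∀ {a A b B} → a ℚ.≤ A → b ℚ.≤ B → mean⁺ a b ℚ.≤ mean⁺ A B
mean⁺-mono-≤ a≤A b≤B = ℚ.*-monoˡ-≤-nonNeg ½ (ℚ.+-monoʳ-≤ 1ℚ (ℚ.+-mono-≤ a≤A b≤B))

mean⁺-mono-< : ∀ {a A b B} → a ℚ.≤ A → b ℚ.≤ B → a ℚ.< A ⊎ b ℚ.< B → mean⁺ a b ℚ.< mean⁺ A B
mean⁺-mono-< {a} {A} {b} {B} a≤A b≤B a<A⊎b<B = ℚ.*-monoʳ-<-pos ½ (ℚ.+-monoʳ-< 1ℚ (+-mono-< a<A⊎b<B))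
  where
  +-mono-< : a ℚ.< A ⊎ b ℚ.< B → a ℚ.+ b ℚ.< A ℚ.+ B
  +-mono-< (inj₁ a<A) = ℚ.+-mono-<-≤ a<A b≤B
  +-mono-< (inj₂ b<B) = ℚ.+-mono-≤-< a≤A b<B

≤⇒<⊎≡ : ∀ {p q} → p ℚ.≤ q → p ℚ.< q ⊎ p ≡ q
≤⇒<⊎≡ {p} {q} p≤q with ℚ.<-cmp p q
... | tri< p<q _ _ = inj₁ p<q
... | tri≈ _ p≡q _ = inj₂ p≡q
... | tri> _ _ q<p = ⊥-elim (ℚ.<-irrefl refl (ℚ.<-≤-trans q<p p≤q))

mean⁺-≡-cancel : ∀ {a A b B} → a ℚ.≤ A → b ℚ.≤ B → mean⁺ a b ≡ mean⁺ A B → a ≡ A × b ≡ B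
mean⁺-≡-cancel a≤A b≤B e with ≤⇒<⊎≡ a≤A | ≤⇒<⊎≡ b≤B
... | inj₂ a≡A | inj₂ b≡B = a≡A , b≡B
... | inj₁ a<A | _        = ⊥-elim (ℚ.<⇒≢ (mean⁺-mono-< a≤A b≤B (inj₁ a<A)) e)
... | inj₂ _   | inj₁ b<B = ⊥-elim (ℚ.<⇒≢ (mean⁺-mono-< a≤A b≤B (inj₂ b<B)) e)

<-mean⁺ : ∀ {a b} → b ℚ.< 1ℚ ℚ.+ a → b ℚ.< mean⁺ a b
<-mean⁺ {a} {b} b<1+a = subst₂ ℚ._<_
  (solve 1 (λ b → con ½ :* (b :+ b) := b) refl b)
  (solve 2 (λ a b → con ½ :* ((con 1ℚ :+ a) :+ b) := con ½ :* (con 1ℚ :+ (a :+ b))) refl a b)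
  (ℚ.*-monoʳ-<-pos ½ (ℚ.+-monoˡ-< b b<1+a))

mean⁺-<-1+ : ∀ {a b} → a ℚ.≤ b → mean⁺ a b ℚ.< 1ℚ ℚ.+ b
mean⁺-<-1+ {a} {b} a≤b = subst₂ ℚ._<_
  (solve 2 (λ a b → con ½ :* (a :+ (con 1ℚ :+ b)) := con ½ :* (con 1ℚ :+ (a :+ b))) refl a b)
  (solve 1 (λ b → con ½ :* ((con 1ℚ :+ b) :+ (con 1ℚ :+ b)) := con 1ℚ :+ b) refl b)
  (ℚ.*-monoʳ-<-pos ½ (ℚ.+-mono-<-≤ (ℚ.≤-<-trans a≤b b<1+b) (ℚ.≤-refl {1ℚ ℚ.+ b})))
  where
  b<1+b : b ℚ.< 1ℚ ℚ.+ b
  b<1+b = subst (ℚ._< 1ℚ ℚ.+ b) (ℚ.+-identityˡ b) (ℚ.+-monoˡ-< b (ℚ.positive⁻¹ 1ℚ))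

-- On the block [pow2 (1+j), pow2 (2+j)] the maximisers are 1 + 2·half₁ j and 1 + 2·half₂ j.
half₁ half₂ : ℕ → ℕ
half₁ zero    = 1
half₁ (suc j) = suc (double (half₂ j))
half₂ zero    = 1
half₂ (suc j) = double (half₁ j)

module BlockMaxima
  (f        : ℕ → ℚ)
  (f-double : ∀ q → f (double q) ≡ f q)
  (f-odd    : ∀ q → f (suc (double q)) ≡ mean⁺ (f q) (f (suc q)))
  (f-one    : f 1 ≡ 1ℚ)
  where

  record MaxOn (h : ℕ) (M : ℚ) (a b : ℕ) : Set where
    field
      bounded   : ∀ {n} → n ∈⟦ h ⟧ → f n ℚ.≤ M
      attainedˡ : f a ≡ M
      attainedʳ : f b ≡ M
      only      : ∀ {n} → n ∈⟦ h ⟧ → f n ≡ M → n ≡ a ⊎ n ≡ b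

  f-4b+1 : ∀ b → f (suc (double (double b))) ≡ mean⁺ (f b) (f (suc (double b)))
  f-4b+1 b = trans (f-odd (double b)) (cong (λ u → mean⁺ u (f (suc (double b)))) (f-double b))

  f-4b+3 : ∀ b → f (suc (double (suc (double b)))) ≡ mean⁺ (f (suc b)) (f (suc (double b)))
  f-4b+3 b = trans (f-odd (suc (double b))) (cong (λ u → ½ ℚ.* (1ℚ ℚ.+ u))
    (trans (cong (f (suc (double b)) ℚ.+_) (f-double (suc b))) (ℚ.+-comm (f (suc (double b))) (f (suc b)))))

  maxOn-step : ∀ {h l r M₀ M₁} →
    MaxOn h M₀ (suc (double l)) (suc (double r)) →
    MaxOn (double h) M₁ (suc (double (suc (double r)))) (suc (double (double l))) →
    M₁ ℚ.< 1ℚ ℚ.+ M₀ →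
    MaxOn (double (double h)) (mean⁺ M₀ M₁)
          (suc (double (suc (double (double l))))) (suc (double (double (suc (double r)))))
  maxOn-step {h} {l} {r} {M₀} {M₁} lower upper M₁<1+M₀ = record
    { bounded   = bounded
    ; attainedˡ = trans (f-4b+3 (double l)) (cong₂ mean⁺ Lo.attainedˡ Hi.attainedʳ)
    ; attainedʳ = trans (f-4b+1 (suc (double r))) (cong₂ mean⁺ Lo.attainedʳ Hi.attainedˡ)
    ; only      = only
    }
    where
    module Lo = MaxOn lower
    module Hi = MaxOn upper

    M₁<M : M₁ ℚ.< mean⁺ M₀ M₁
    M₁<M = <-mean⁺ {M₀} M₁<1+M₀

    even-not-max : ∀ {c e} → c ≡ double e → c ≡ suc (double l) ⊎ c ≡ suc (double r) → ⊥
    even-not-max c≡2e (inj₁ c≡2l+1) = double≢odd (trans (sym c≡2e) c≡2l+1)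
    even-not-max c≡2e (inj₂ c≡2r+1) = double≢odd (trans (sym c≡2e) c≡2r+1)

    bounded : ∀ {n} → n ∈⟦ double (double h) ⟧ → f n ℚ.≤ mean⁺ M₀ M₁
    bounded {n} n∈ with mod4 n
    ... | 2c c   = ℚ.≤-trans (ℚ.≤-reflexive (f-double c)) (ℚ.<⇒≤ (ℚ.≤-<-trans (Hi.bounded (∈⟦⟧-double n∈)) M₁<M))
    ... | 4b+1 b = let (b∈ , 2b+1∈) = ∈⟦⟧-4b+1 n∈ in
      ℚ.≤-trans (ℚ.≤-reflexive (f-4b+1 b)) (mean⁺-mono-≤ (Lo.bounded b∈) (Hi.bounded 2b+1∈))
    ... | 4b+3 b = let (b+1∈ , 2b+1∈) = ∈⟦⟧-4b+3 n∈ in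
      ℚ.≤-trans (ℚ.≤-reflexive (f-4b+3 b)) (mean⁺-mono-≤ (Lo.bounded b+1∈) (Hi.bounded 2b+1∈))

    only : ∀ {n} → n ∈⟦ double (double h) ⟧ → f n ≡ mean⁺ M₀ M₁ →
           n ≡ suc (double (suc (double (double l)))) ⊎ n ≡ suc (double (double (suc (double r))))
    only {n} n∈ fn≡M with mod4 n
    ... | 2c c = ⊥-elim (ℚ.<⇒≢ (ℚ.≤-<-trans (Hi.bounded (∈⟦⟧-double n∈)) M₁<M) (trans (sym (f-double c)) fn≡M))
    ... | 4b+1 b with ∈⟦⟧-4b+1 n∈
    ...   | b∈ , 2b+1∈ with mean⁺-≡-cancel (Lo.bounded b∈) (Hi.bounded 2b+1∈) (trans (sym (f-4b+1 b)) fn≡M)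
    ...     | fb≡M₀ , f2b+1≡M₁ with Hi.only 2b+1∈ f2b+1≡M₁
    ...       | inj₁ 2b+1≡4r+3 = inj₂ (cong (λ b → suc (double (double b))) (odd-injective 2b+1≡4r+3))
    ...       | inj₂ 2b+1≡4l+1 = ⊥-elim (even-not-max (odd-injective 2b+1≡4l+1) (Lo.only b∈ fb≡M₀))
    only {n} n∈ fn≡M | 4b+3 b with ∈⟦⟧-4b+3 n∈
    ...   | b+1∈ , 2b+1∈ with mean⁺-≡-cancel (Lo.bounded b+1∈) (Hi.bounded 2b+1∈) (trans (sym (f-4b+3 b)) fn≡M)
    ...     | fb+1≡M₀ , f2b+1≡M₁ with Hi.only 2b+1∈ f2b+1≡M₁
    ...       | inj₂ 2b+1≡4l+1 = inj₁ (cong (λ b → suc (double (suc (double b)))) (odd-injective 2b+1≡4l+1))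
    ...       | inj₁ 2b+1≡4r+3 = ⊥-elim (even-not-max (cong suc (odd-injective 2b+1≡4r+3)) (Lo.only b+1∈ fb+1≡M₀))

  private
    ≡⇒≤ : ∀ {n p q} → f n ≡ p → {True (p ℚ.≤? q)} → f n ℚ.≤ q
    ≡⇒≤ fn≡p {p≤q} = ℚ.≤-trans (ℚ.≤-reflexive fn≡p) (toWitness p≤q)

    ≡⇒≢ : ∀ {n p q} → f n ≡ p → {False (p ℚ.≟ q)} → f n ≢ q
    ≡⇒≢ fn≡p {p≢q} fn≡q = toWitnessFalse p≢q (trans (sym fn≡p) fn≡q)

    f2 : f 2 ≡ 1ℚ
    f2 = trans (f-double 1) f-one
    f3 : f 3 ≡ + 3 ℚ./ 2
    f3 = trans (f-odd 1) (cong₂ mean⁺ f-one f2)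
    f4 : f 4 ≡ 1ℚ
    f4 = trans (f-double 2) f2
    f5 : f 5 ≡ + 7 ℚ./ 4
    f5 = trans (f-odd 2) (cong₂ mean⁺ f2 f3)
    f6 : f 6 ≡ + 3 ℚ./ 2
    f6 = trans (f-double 3) f3
    f7 : f 7 ≡ + 7 ℚ./ 4
    f7 = trans (f-odd 3) (cong₂ mean⁺ f3 f4)
    f8 : f 8 ≡ 1ℚ
    f8 = trans (f-double 4) f4

  maxOn-2 : MaxOn 2 (+ 3 ℚ./ 2) 3 3
  maxOn-2 = record
    { bounded   = ∈⟦⟧-elim (λ n → f n ℚ.≤ + 3 ℚ./ 2) 2 λ where
        0 _ → ≡⇒≤ f2
        1 _ → ≡⇒≤ f3
        2 _ → ≡⇒≤ f4
        (suc (suc (suc _))) (s≤s (s≤s ()))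
    ; attainedˡ = f3
    ; attainedʳ = f3
    ; only      = ∈⟦⟧-elim (λ n → f n ≡ + 3 ℚ./ 2 → n ≡ 3 ⊎ n ≡ 3) 2 λ where
        0 _ e → ⊥-elim (≡⇒≢ f2 e)
        1 _ _ → inj₁ refl
        2 _ e → ⊥-elim (≡⇒≢ f4 e)
        (suc (suc (suc _))) (s≤s (s≤s ()))
    }

  maxOn-4 : MaxOn 4 (+ 7 ℚ./ 4) 7 5
  maxOn-4 = record
    { bounded   = ∈⟦⟧-elim (λ n → f n ℚ.≤ + 7 ℚ./ 4) 4 λ where
        0 _ → ≡⇒≤ f4
        1 _ → ≡⇒≤ f5
        2 _ → ≡⇒≤ f6
        3 _ → ≡⇒≤ f7
        4 _ → ≡⇒≤ f8
        (suc (suc (suc (suc (suc _))))) (s≤s (s≤s (s≤s (s≤s ()))))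
    ; attainedˡ = f7
    ; attainedʳ = f5
    ; only      = ∈⟦⟧-elim (λ n → f n ≡ + 7 ℚ./ 4 → n ≡ 7 ⊎ n ≡ 5) 4 λ where
        0 _ e → ⊥-elim (≡⇒≢ f4 e)
        1 _ _ → inj₂ refl
        2 _ e → ⊥-elim (≡⇒≢ f6 e)
        3 _ _ → inj₁ refl
        4 _ e → ⊥-elim (≡⇒≢ f8 e)
        (suc (suc (suc (suc (suc _))))) (s≤s (s≤s (s≤s (s≤s ()))))
    }

  record TwoBlocks (j : ℕ) : Set where
    field
      M₀ M₁   : ℚ
      lower   : MaxOn (pow2 (suc j)) M₀ (suc (double (half₁ j))) (suc (double (half₂ j)))
      upper   : MaxOn (pow2 (suc (suc j))) M₁ (suc (double (half₁ (suc j)))) (suc (double (half₂ (suc j))))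
      M₀≤M₁   : M₀ ℚ.≤ M₁
      M₁<1+M₀ : M₁ ℚ.< 1ℚ ℚ.+ M₀

  twoBlocks : ∀ j → TwoBlocks j
  twoBlocks zero = record
    { M₀      = + 3 ℚ./ 2
    ; M₁      = + 7 ℚ./ 4
    ; lower   = maxOn-2
    ; upper   = maxOn-4
    ; M₀≤M₁   = from-yes (+ 3 ℚ./ 2 ℚ.≤? + 7 ℚ./ 4)
    ; M₁<1+M₀ = from-yes (+ 7 ℚ./ 4 ℚ.<? 1ℚ ℚ.+ + 3 ℚ./ 2)
    }
  twoBlocks (suc j) = record
    { lower   = upper
    ; upper   = maxOn-step lower upper M₁<1+M₀
    ; M₀≤M₁   = ℚ.<⇒≤ (<-mean⁺ {M₀} M₁<1+M₀)
    ; M₁<1+M₀ = mean⁺-<-1+ M₀≤M₁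
    }
    where open TwoBlocks (twoBlocks j)

  maxOn-block : ∀ j → Σ ℚ λ M → MaxOn (pow2 (suc j)) M (suc (double (half₁ j))) (suc (double (half₂ j)))
  maxOn-block j = M₀ , lower
    where open TwoBlocks (twoBlocks j)

-- The maximisers in closed form

4^[1+k]≡1+3c : ∀ k c → 2 ^ (2 * k) ≡ suc (3 * c) → 2 ^ (2 * suc k) ≡ suc (3 * (1 + 4 * c))
4^[1+k]≡1+3c k c 4^k≡1+3c = begin
  2 ^ (2 * suc k)        ≡⟨ cong (2 ^_) (ℕ.*-suc 2 k) ⟩
  2 * (2 * 2 ^ (2 * k))  ≡⟨ cong (λ p → 2 * (2 * p)) 4^k≡1+3c ⟩
  2 * (2 * suc (3 * c))  ≡⟨ arith c ⟩
  suc (3 * (1 + 4 * c))  ∎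
  where
  open ≡-Reasoning
  arith : ∀ c → 2 * (2 * suc (3 * c)) ≡ suc (3 * (1 + 4 * c))
  arith = solve-∀

4^k≡1+3c : ∀ k → Σ ℕ λ c → 2 ^ (2 * k) ≡ suc (3 * c)
4^k≡1+3c zero    = 0 , refl
4^k≡1+3c (suc k) with 4^k≡1+3c k
... | c , 4^k≡1+3c = 1 + 4 * c , 4^[1+k]≡1+3c k c 4^k≡1+3c

x≡2c : ∀ k c → 2 ^ (2 * k) ≡ suc (3 * c) → x k ≡ 2 * c
x≡2c k c 4^k≡1+3c = begin
  2 * (2 ^ (2 * k) ∸ 1) / 3  ≡⟨ cong (λ p → 2 * (p ∸ 1) / 3) 4^k≡1+3c ⟩
  2 * (3 * c) / 3            ≡⟨ cong (_/ 3) (trans (cong (2 *_) (ℕ.*-comm 3 c)) (sym (ℕ.*-assoc 2 c 3))) ⟩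
  2 * c * 3 / 3              ≡⟨ m*n/n≡m (2 * c) 3 ⟩
  2 * c                      ∎
  where open ≡-Reasoning

x-suc : ∀ k → x (suc k) ≡ 2 + 4 * x k
x-suc k with 4^k≡1+3c k
... | c , 4^k≡1+3c = begin
  x (suc k)        ≡⟨ x≡2c (suc k) (1 + 4 * c) (4^[1+k]≡1+3c k c 4^k≡1+3c) ⟩
  2 * (1 + 4 * c)  ≡⟨ arith c ⟩
  2 + 4 * (2 * c)  ≡⟨ cong (λ z → 2 + 4 * z) (sym (x≡2c k c 4^k≡1+3c)) ⟩
  2 + 4 * x k      ∎
  where
  open ≡-Reasoning
  arith : ∀ c → 2 * (1 + 4 * c) ≡ 2 + 4 * (2 * c)
  arith = solve-∀

half₁-closed : ∀ j → double (half₁ j) ≡ 2 ^ suc j + x (suc j / 2)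
half₂-closed : ∀ j → double (half₂ j) ≡ 2 ^ suc j + y (j / 2)

half₁-closed zero    = refl
half₁-closed (suc j) = begin
  double (suc (double (half₂ j)))        ≡⟨ double≡2* _ ⟩
  2 * suc (double (half₂ j))             ≡⟨ cong (λ d → 2 * suc d) (half₂-closed j) ⟩
  2 * suc (2 ^ suc j + 2 * x (j / 2))    ≡⟨ arith (2 ^ suc j) (x (j / 2)) ⟩
  2 * 2 ^ suc j + (2 + 4 * x (j / 2))    ≡⟨ cong (λ z → 2 * 2 ^ suc j + z) (sym (x-suc (j / 2))) ⟩
  2 * 2 ^ suc j + x (suc (j / 2))        ≡⟨ cong (λ k → 2 * 2 ^ suc j + x k) (sym (m/n≡1+[m∸n]/n {suc (suc j)} {2} (s≤s (s≤s z≤n)))) ⟩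
  2 ^ suc (suc j) + x (suc (suc j) / 2)  ∎
  where
  open ≡-Reasoning
  arith : ∀ p w → 2 * suc (p + 2 * w) ≡ 2 * p + (2 + 4 * w)
  arith = solve-∀

half₂-closed zero    = refl
half₂-closed (suc j) = begin
  double (double (half₁ j))        ≡⟨ double≡2* _ ⟩
  2 * double (half₁ j)             ≡⟨ cong (2 *_) (half₁-closed j) ⟩
  2 * (2 ^ suc j + x (suc j / 2))  ≡⟨ ℕ.*-distribˡ-+ 2 (2 ^ suc j) (x (suc j / 2)) ⟩
  2 ^ suc (suc j) + y (suc j / 2)  ∎
  where open ≡-Reasoning

half₁-bounds : ∀ j → pow2 j ≤ half₁ j × half₁ j < pow2 (suc j)
half₂-bounds : ∀ j → pow2 j ≤ half₂ j × half₂ j < pow2 (suc j)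

half₁-bounds zero    = s≤s z≤n , s≤s (s≤s z≤n)
half₁-bounds (suc j) with half₂-bounds j
... | lo , hi = ≤-trans (double-mono-≤ lo) (n≤1+n _) , double-mono-≤ hi
half₂-bounds zero    = s≤s z≤n , s≤s (s≤s z≤n)
half₂-bounds (suc j) with half₁-bounds j
... | lo , hi = double-mono-≤ lo , ≤-trans (n≤1+n _) (double-mono-≤ hi)

half₁≢half₂ : ∀ j → half₁ (suc j) ≢ half₂ (suc j)
half₁≢half₂ j = double≢odd ∘ sym

-- The largest odd divisor

odd%2≡1 : ∀ q → suc (double q) % 2 ≡ 1
odd%2≡1 zero    = refl
odd%2≡1 (suc q) = odd%2≡1 q

%2≡1⇒coprime-2 : ∀ n → n % 2 ≡ 1 → Coprime n 2
%2≡1⇒coprime-2 (suc zero)    _ = 1-coprimeTo 2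
%2≡1⇒coprime-2 (suc (suc n)) e = coprime-+ (%2≡1⇒coprime-2 n e)

coprime-2⇒∣double⇔∣ : ∀ {d k} → Coprime d 2 → d ∣ double k ⇔ d ∣ k
coprime-2⇒∣double⇔∣ {d} {k} cop = mk⇔
  (λ d∣2k → coprime-divisor cop (subst (d ∣_) (double≡2* k) d∣2k))
  (λ d∣k → subst (d ∣_) (sym (double≡+ k)) (∣m∣n⇒∣m+n d∣k d∣k))

does-cong : ∀ {A B : Set} → A ⇔ B → (a? : Dec A) (b? : Dec B) → does a? ≡ does b?
does-cong A⇔B (yes a) b? = sym (dec-true b? (Equivalence.to A⇔B a))
does-cong A⇔B (no ¬a) b? = sym (dec-false b? (¬a ∘ Equivalence.from A⇔B))

oddDivisorTest-double : ∀ d k →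
  (does (suc d ∣? double k) ∧ (suc d % 2 ≡ᵇ 1)) ≡ (does (suc d ∣? k) ∧ (suc d % 2 ≡ᵇ 1))
oddDivisorTest-double d k with suc d % 2 ≡ᵇ 1 in odd
... | false = trans (∧-zeroʳ _) (sym (∧-zeroʳ _))
... | true  = trans (∧-identityʳ _) (trans same-divisibility (sym (∧-identityʳ _)))
  where
  same-divisibility : does (suc d ∣? double k) ≡ does (suc d ∣? k)
  same-divisibility = does-cong
    (coprime-2⇒∣double⇔∣ (%2≡1⇒coprime-2 (suc d) (≡ᵇ⇒≡ _ 1 (subst T (sym odd) _))))
    (suc d ∣? double k) (suc d ∣? k)

oddDivSearch-double : ∀ d k → oddDivSearch d (double k) ≡ oddDivSearch d k
oddDivSearch-double zero    k = refl
oddDivSearch-double (suc d) k rewrite oddDivisorTest-double d k | oddDivSearch-double d k = refl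

oddDivSearch-above : ∀ j k → oddDivSearch (j + suc k) (suc k) ≡ α (suc k)
oddDivSearch-above zero    k = refl
oddDivSearch-above (suc j) k
  rewrite dec-false (suc (j + suc k) ∣? suc k) (>⇒∤ (s≤s (m≤n+m (suc k) j))) = oddDivSearch-above j k

α-odd : ∀ q → α (suc (double q)) ≡ suc (double q)
α-odd q rewrite dec-true (suc (double q) ∣? suc (double q)) ∣-refl | odd%2≡1 q = refl

α-double : ∀ k → α (double (suc k)) ≡ α (suc k)
α-double k = begin
  oddDivSearch (double (suc k)) (double (suc k)) ≡⟨ oddDivSearch-double (double (suc k)) (suc k) ⟩
  oddDivSearch (double (suc k)) (suc k)          ≡⟨ cong (λ d → oddDivSearch d (suc k)) (double≡+ (suc k)) ⟩
  oddDivSearch (suc k + suc k) (suc k)           ≡⟨ oddDivSearch-above (suc k) k ⟩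
  α (suc k)                                      ∎
  where open ≡-Reasoning

fromℕ : ℕ → ℚ
fromℕ n = + n ℚ./ 1
/-≡ : ∀ {i j} m n → i ℤ.* + suc n ≡ j ℤ.* + suc m → i ℚ./ suc m ≡ j ℚ./ suc n
/-≡ {i} {j} m n e = ℚ.fromℚᵘ-cong {ℚᵘ.mkℚᵘ i m} {ℚᵘ.mkℚᵘ j n} (ℚᵘ.*≡* e)

/-+-/ : ∀ i j m n →
  i ℚ./ suc m ℚ.+ j ℚ./ suc n ≡ (i ℤ.* + suc n ℤ.+ j ℤ.* + suc m) ℚ./ (suc m * suc n)
/-+-/ i j m n = trans (sym (ℚ.fromℚᵘ-toℚᵘ _)) (ℚ.fromℚᵘ-cong {y = ℚᵘ.mkℚᵘ i m ℚᵘ.+ ℚᵘ.mkℚᵘ j n} (ℚᵘ.≃-trans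
  (ℚ.toℚᵘ-homo-+ (i ℚ./ suc m) (j ℚ./ suc n))
  (ℚᵘ.+-cong (ℚ.toℚᵘ-fromℚᵘ (ℚᵘ.mkℚᵘ i m)) (ℚ.toℚᵘ-fromℚᵘ (ℚᵘ.mkℚᵘ j n)))))

/-*-/ : ∀ i j m n → (i ℚ./ suc m) ℚ.* (j ℚ./ suc n) ≡ (i ℤ.* j) ℚ./ (suc m * suc n)
/-*-/ i j m n = trans (sym (ℚ.fromℚᵘ-toℚᵘ _)) (ℚ.fromℚᵘ-cong {y = ℚᵘ.mkℚᵘ i m ℚᵘ.* ℚᵘ.mkℚᵘ j n} (ℚᵘ.≃-trans
  (ℚ.toℚᵘ-homo-* (i ℚ./ suc m) (j ℚ./ suc n))
  (ℚᵘ.*-cong (ℚ.toℚᵘ-fromℚᵘ (ℚᵘ.mkℚᵘ i m)) (ℚ.toℚᵘ-fromℚᵘ (ℚᵘ.mkℚᵘ j n)))))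

/-distribʳ-+ : ∀ i j d → (i ℤ.+ j) ℚ./ suc d ≡ i ℚ./ suc d ℚ.+ j ℚ./ suc d
/-distribʳ-+ i j d = sym (trans (/-+-/ i j d d)
  (/-≡ {i ℤ.* s ℤ.+ j ℤ.* s} {i ℤ.+ j} (d + d * suc d) d
       (trans (cong (ℤ._* s) (sym (ℤ.*-distribʳ-+ s i j))) (ℤ.*-assoc (i ℤ.+ j) s s))))
  where
  s : ℤ
  s = + suc d

fromℕ-+ : ∀ a b → fromℕ (a + b) ≡ fromℕ a ℚ.+ fromℕ b
fromℕ-+ a b = /-distribʳ-+ (+ a) (+ b) 0

fromℕ-* : ∀ a b → fromℕ (a * b) ≡ fromℕ a ℚ.* fromℕ b
fromℕ-* a b = sym (trans (/-*-/ (+ a) (+ b) 0 0) (ℚ./-cong (sym (ℤ.pos-* a b)) refl))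

fromℕ-suc : ∀ n → fromℕ (suc n) ≡ fromℕ n ℚ.+ 1ℚ
fromℕ-suc n = trans (fromℕ-+ 1 n) (ℚ.+-comm 1ℚ (fromℕ n))

fromℕ-double : ∀ n → fromℕ (double n) ≡ fromℕ n ℚ.+ fromℕ n
fromℕ-double n = trans (cong fromℕ (double≡+ n)) (fromℕ-+ n n)

/-as-* : ∀ a d → + a ℚ./ suc d ≡ fromℕ a ℚ.* (+ 1 ℚ./ suc d)
/-as-* a d = sym (trans (/-*-/ (+ a) (+ 1) 0 d) (ℚ./-cong (ℤ.*-identityʳ (+ a)) (ℕ.*-identityˡ (suc d))))

recip-*-cancel : ∀ k → (+ 1 ℚ./ suc k) ℚ.* fromℕ (suc k) ≡ 1ℚ
recip-*-cancel k = trans (/-*-/ (+ 1) (+ suc k) k 0)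
  (trans (ℚ./-cong (ℤ.*-identityˡ (+ suc k)) (ℕ.*-identityʳ (suc k)))
         (/-≡ {+ suc k} {+ 1} k 0 (ℤ.*-comm (+ suc k) (+ 1))))

recip-double : ∀ q → + 1 ℚ./ double (suc q) ≡ ½ ℚ.* (+ 1 ℚ./ suc q)
recip-double q = sym (trans (/-*-/ (+ 1) (+ 1) 1 q) (ℚ./-cong {+ 1} refl (sym (double≡2* (suc q)))))


-- The sums behind G, and the function U

αRatio : ℕ → ℚ
αRatio zero    = 0ℚ
αRatio (suc i) = (+ 1 ℚ./ suc i) ℚ.* fromℕ (α (suc i))

Σα/k : ℕ → ℚ
Σα/k zero    = 0ℚ
Σα/k (suc n) = Σα/k n ℚ.+ αRatio (suc n)

ΣΣα/k : ℕ → ℚ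
ΣΣα/k zero    = 0ℚ
ΣΣα/k (suc n) = ΣΣα/k n ℚ.+ Σα/k n

αRatio-odd : ∀ q → αRatio (suc (double q)) ≡ 1ℚ
αRatio-odd q = trans (cong (λ a → (+ 1 ℚ./ suc (double q)) ℚ.* fromℕ a) (α-odd q)) (recip-*-cancel (double q))

αRatio-double : ∀ q → αRatio (double (suc q)) ≡ ½ ℚ.* αRatio (suc q)
αRatio-double q = begin
  (+ 1 ℚ./ double (suc q)) ℚ.* fromℕ (α (double (suc q)))  ≡⟨ cong₂ ℚ._*_ (recip-double q) (cong fromℕ (α-double q)) ⟩
  (½ ℚ.* (+ 1 ℚ./ suc q)) ℚ.* fromℕ (α (suc q))          ≡⟨ ℚ.*-assoc ½ (+ 1 ℚ./ suc q) (fromℕ (α (suc q))) ⟩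
  ½ ℚ.* αRatio (suc q)                                     ∎
  where open ≡-Reasoning

Σα/k-odd : ∀ q → Σα/k (suc (double q)) ≡ Σα/k (double q) ℚ.+ 1ℚ
Σα/k-odd q = cong (Σα/k (double q) ℚ.+_) (αRatio-odd q)

Σα/k-double : ∀ q → Σα/k (double q) ≡ fromℕ q ℚ.+ ½ ℚ.* Σα/k q
Σα/k-double zero    = refl
Σα/k-double (suc q) = begin
  Σα/k (suc (double q)) ℚ.+ αRatio (double (suc q))
    ≡⟨ cong₂ ℚ._+_ (trans (Σα/k-odd q) (cong (ℚ._+ 1ℚ) (Σα/k-double q))) (αRatio-double q) ⟩
  (fromℕ q ℚ.+ ½ ℚ.* Σα/k q ℚ.+ 1ℚ) ℚ.+ ½ ℚ.* αRatio (suc q)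
    ≡⟨ solve 3 (λ n s r → (n :+ con ½ :* s :+ con 1ℚ) :+ con ½ :* r := (n :+ con 1ℚ) :+ con ½ :* (s :+ r))
             refl (fromℕ q) (Σα/k q) (αRatio (suc q)) ⟩
  (fromℕ q ℚ.+ 1ℚ) ℚ.+ ½ ℚ.* Σα/k (suc q)
    ≡⟨ cong (ℚ._+ ½ ℚ.* Σα/k (suc q)) (sym (fromℕ-suc q)) ⟩
  fromℕ (suc q) ℚ.+ ½ ℚ.* Σα/k (suc q) ∎
  where open ≡-Reasoning

ΣΣα/k-double : ∀ q → ΣΣα/k (double q) ≡ fromℕ q ℚ.* fromℕ q ℚ.+ ΣΣα/k q
ΣΣα/k-double zero    = refl
ΣΣα/k-double (suc q) = begin
  (ΣΣα/k (double q) ℚ.+ Σα/k (double q)) ℚ.+ Σα/k (suc (double q))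
    ≡⟨ cong₂ ℚ._+_ (cong₂ ℚ._+_ (ΣΣα/k-double q) (Σα/k-double q))
                   (trans (Σα/k-odd q) (cong (ℚ._+ 1ℚ) (Σα/k-double q))) ⟩
  (fromℕ q ℚ.* fromℕ q ℚ.+ ΣΣα/k q ℚ.+ (fromℕ q ℚ.+ ½ ℚ.* Σα/k q)) ℚ.+ (fromℕ q ℚ.+ ½ ℚ.* Σα/k q ℚ.+ 1ℚ)
    ≡⟨ solve 3 (λ n t s → (n :* n :+ t :+ (n :+ con ½ :* s)) :+ (n :+ con ½ :* s :+ con 1ℚ)
                         := (n :+ con 1ℚ) :* (n :+ con 1ℚ) :+ (t :+ s))
             refl (fromℕ q) (ΣΣα/k q) (Σα/k q) ⟩
  (fromℕ q ℚ.+ 1ℚ) ℚ.* (fromℕ q ℚ.+ 1ℚ) ℚ.+ ΣΣα/k (suc q)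
    ≡⟨ cong (λ n → n ℚ.* n ℚ.+ ΣΣα/k (suc q)) (sym (fromℕ-suc q)) ⟩
  fromℕ (suc q) ℚ.* fromℕ (suc q) ℚ.+ ΣΣα/k (suc q) ∎
  where open ≡-Reasoning

Gterm-suc : ∀ {n i} → i ≤ n → Gterm (suc n) i ≡ Gterm n i ℚ.+ αRatio (suc i)
Gterm-suc {n} {i} i≤n = begin
  (+ (suc n ∸ i) ℚ./ suc i) ℚ.* a
    ≡⟨ cong (λ m → (+ m ℚ./ suc i) ℚ.* a) (ℕ.+-∸-assoc 1 i≤n) ⟩
  (+ (suc (n ∸ i)) ℚ./ suc i) ℚ.* a
    ≡⟨ cong (ℚ._* a) (/-distribʳ-+ (+ 1) (+ (n ∸ i)) i) ⟩
  (+ 1 ℚ./ suc i ℚ.+ + (n ∸ i) ℚ./ suc i) ℚ.* a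
    ≡⟨ solve 3 (λ r s a → (r :+ s) :* a := s :* a :+ r :* a) refl (+ 1 ℚ./ suc i) (+ (n ∸ i) ℚ./ suc i) a ⟩
  Gterm n i ℚ.+ αRatio (suc i) ∎
  where
  open ≡-Reasoning
  a : ℚ
  a = fromℕ (α (suc i))

Gsum-suc : ∀ n {j} → j ≤ suc n → Gsum (suc n) j ≡ Gsum n j ℚ.+ Σα/k j
Gsum-suc n {zero}  _           = refl
Gsum-suc n {suc j} (s≤s j≤n) = begin
  Gsum (suc n) j ℚ.+ Gterm (suc n) j
    ≡⟨ cong₂ ℚ._+_ (Gsum-suc n (ℕ.m≤n⇒m≤1+n j≤n)) (Gterm-suc j≤n) ⟩
  (Gsum n j ℚ.+ Σα/k j) ℚ.+ (Gterm n j ℚ.+ αRatio (suc j))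
    ≡⟨ solve 4 (λ g s t r → (g :+ s) :+ (t :+ r) := (g :+ t) :+ (s :+ r))
             refl (Gsum n j) (Σα/k j) (Gterm n j) (αRatio (suc j)) ⟩
  Gsum n (suc j) ℚ.+ Σα/k (suc j) ∎
  where open ≡-Reasoning

Gterm-diag : ∀ n → Gterm n n ≡ 0ℚ
Gterm-diag n = begin
  (+ (n ∸ n) ℚ./ suc n) ℚ.* fromℕ (α (suc n)) ≡⟨ cong (λ m → (+ m ℚ./ suc n) ℚ.* fromℕ (α (suc n))) (ℕ.n∸n≡0 n) ⟩
  (+ 0 ℚ./ suc n) ℚ.* fromℕ (α (suc n))       ≡⟨ cong (ℚ._* fromℕ (α (suc n))) (ℚ.0/n≡0 (suc n)) ⟩
  0ℚ ℚ.* fromℕ (α (suc n))                   ≡⟨ ℚ.*-zeroˡ (fromℕ (α (suc n))) ⟩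
  0ℚ                                         ∎
  where open ≡-Reasoning

G≡ΣΣα/k : ∀ n → G n ≡ ΣΣα/k (suc n)
G≡ΣΣα/k zero    = refl
G≡ΣΣα/k (suc n) = begin
  Gsum (suc n) (suc n)                         ≡⟨ Gsum-suc n ℕ.≤-refl ⟩
  (Gsum n n ℚ.+ Gterm n n) ℚ.+ Σα/k (suc n)    ≡⟨ cong (λ t → (G n ℚ.+ t) ℚ.+ Σα/k (suc n)) (Gterm-diag n) ⟩
  (G n ℚ.+ 0ℚ) ℚ.+ Σα/k (suc n)                ≡⟨ cong (λ t → t ℚ.+ Σα/k (suc n)) (trans (ℚ.+-identityʳ (G n)) (G≡ΣΣα/k n)) ⟩
  ΣΣα/k (suc (suc n))                          ∎
  where open ≡-Reasoning

U : ℕ → ℚ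
U n = fromℕ n ℚ.* fromℕ n ℚ.- fromℕ 3 ℚ.* ΣΣα/k n

U-one : U 1 ≡ 1ℚ
U-one = refl

U-double : ∀ q → U (double q) ≡ U q
U-double q = begin
  fromℕ (double q) ℚ.* fromℕ (double q) ℚ.- fromℕ 3 ℚ.* ΣΣα/k (double q)
    ≡⟨ cong₂ (λ n t → n ℚ.* n ℚ.- fromℕ 3 ℚ.* t) (fromℕ-double q) (ΣΣα/k-double q) ⟩
  (fromℕ q ℚ.+ fromℕ q) ℚ.* (fromℕ q ℚ.+ fromℕ q) ℚ.- fromℕ 3 ℚ.* (fromℕ q ℚ.* fromℕ q ℚ.+ ΣΣα/k q)
    ≡⟨ solve 2 (λ n t → (n :+ n) :* (n :+ n) :- con (fromℕ 3) :* (n :* n :+ t) := n :* n :- con (fromℕ 3) :* t)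
             refl (fromℕ q) (ΣΣα/k q) ⟩
  U q ∎
  where open ≡-Reasoning

U-odd : ∀ q → U (suc (double q)) ≡ mean⁺ (U q) (U (suc q))
U-odd q = begin
  fromℕ (suc (double q)) ℚ.* fromℕ (suc (double q)) ℚ.- fromℕ 3 ℚ.* (ΣΣα/k (double q) ℚ.+ Σα/k (double q))
    ≡⟨ cong₂ (λ m u → m ℚ.* m ℚ.- fromℕ 3 ℚ.* u)
             (trans (fromℕ-suc (double q)) (cong (ℚ._+ 1ℚ) (fromℕ-double q)))
             (cong₂ ℚ._+_ (ΣΣα/k-double q) (Σα/k-double q)) ⟩
  (n ℚ.+ n ℚ.+ 1ℚ) ℚ.* (n ℚ.+ n ℚ.+ 1ℚ) ℚ.- fromℕ 3 ℚ.* ((n ℚ.* n ℚ.+ t) ℚ.+ (n ℚ.+ ½ ℚ.* s))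
    ≡⟨ solve 3 (λ n t s → (n :+ n :+ con 1ℚ) :* (n :+ n :+ con 1ℚ) :- con (fromℕ 3) :* ((n :* n :+ t) :+ (n :+ con ½ :* s))
                         := con ½ :* (con 1ℚ :+ ((n :* n :- con (fromℕ 3) :* t)
                              :+ ((n :+ con 1ℚ) :* (n :+ con 1ℚ) :- con (fromℕ 3) :* (t :+ s)))))
             refl n t s ⟩
  mean⁺ (U q) ((n ℚ.+ 1ℚ) ℚ.* (n ℚ.+ 1ℚ) ℚ.- fromℕ 3 ℚ.* ΣΣα/k (suc q))
    ≡⟨ cong (λ m → mean⁺ (U q) (m ℚ.* m ℚ.- fromℕ 3 ℚ.* ΣΣα/k (suc q))) (sym (fromℕ-suc q)) ⟩
  mean⁺ (U q) (U (suc q)) ∎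
  where
  open ≡-Reasoning
  n = fromℕ q
  t = ΣΣα/k q
  s = Σα/k q

g≡U : ∀ n → g n ≡ (U (suc n) ℚ.- 1ℚ) ℚ.* (+ 1 ℚ./ 3)
g≡U n = begin
  + (n * (n + 2)) ℚ./ 3 ℚ.- G n
    ≡⟨ cong₂ ℚ._-_ (trans (/-as-* (n * (n + 2)) 2) (cong (ℚ._* third) (trans (fromℕ-* n (n + 2)) (cong (fromℕ n ℚ.*_) (fromℕ-+ n 2)))))
                   (G≡ΣΣα/k n) ⟩
  fromℕ n ℚ.* (fromℕ n ℚ.+ fromℕ 2) ℚ.* third ℚ.- ΣΣα/k (suc n)
    ≡⟨ solve 2 (λ m t → m :* (m :+ con (fromℕ 2)) :* con third :- t
                       := ((m :+ con 1ℚ) :* (m :+ con 1ℚ) :- con (fromℕ 3) :* t :- con 1ℚ) :* con third)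
             refl (fromℕ n) (ΣΣα/k (suc n)) ⟩
  ((fromℕ n ℚ.+ 1ℚ) ℚ.* (fromℕ n ℚ.+ 1ℚ) ℚ.- fromℕ 3 ℚ.* ΣΣα/k (suc n) ℚ.- 1ℚ) ℚ.* third
    ≡⟨ cong (λ m → (m ℚ.* m ℚ.- fromℕ 3 ℚ.* ΣΣα/k (suc n) ℚ.- 1ℚ) ℚ.* third) (sym (fromℕ-suc n)) ⟩
  (U (suc n) ℚ.- 1ℚ) ℚ.* third ∎
  where
  open ≡-Reasoning
  third : ℚ
  third = + 1 ℚ./ 3

open BlockMaxima U U-double U-odd U-one

g-≤⇔U-≤ : ∀ a b → g a ℚ.≤ g b ⇔ U (suc a) ℚ.≤ U (suc b)
g-≤⇔U-≤ a b = mk⇔ to from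
  where
  third : ℚ
  third = + 1 ℚ./ 3
  -1+1 : ∀ u → u ℚ.- 1ℚ ℚ.+ 1ℚ ≡ u
  -1+1 = solve 1 (λ u → u :- con 1ℚ :+ con 1ℚ := u) refl
  to : g a ℚ.≤ g b → U (suc a) ℚ.≤ U (suc b)
  to ga≤gb = subst₂ ℚ._≤_ (-1+1 (U (suc a))) (-1+1 (U (suc b)))
    (ℚ.+-monoˡ-≤ 1ℚ (ℚ.*-cancelʳ-≤-pos {U (suc a) ℚ.- 1ℚ} {U (suc b) ℚ.- 1ℚ} third
      (subst₂ ℚ._≤_ (g≡U a) (g≡U b) ga≤gb)))
  from : U (suc a) ℚ.≤ U (suc b) → g a ℚ.≤ g b
  from Ua≤Ub = subst₂ ℚ._≤_ (sym (g≡U a)) (sym (g≡U b))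
    (ℚ.*-monoʳ-≤-nonNeg third {U (suc a) ℚ.- 1ℚ} {U (suc b) ℚ.- 1ℚ} (ℚ.+-monoˡ-≤ (ℚ.- 1ℚ) Ua≤Ub))

g-argmax : ∀ {h M t₁ t₂} → MaxOn h M (suc t₁) (suc t₂) → h ≤ t₁ → t₁ < double h →
  ∀ t → h ≤ t → t < double h →
  (∀ s → h ≤ s → s < double h → g s ℚ.≤ g t) ⇔ (t ≡ t₁ ⊎ t ≡ t₂)
g-argmax {h} {M} {t₁} {t₂} max h≤t₁ t₁<2h t h≤t t<2h = mk⇔ to from
  where
  open MaxOn max

  suc∈ : ∀ {s} → h ≤ s → s < double h → suc s ∈⟦ h ⟧
  suc∈ h≤s s<2h = ≤-trans h≤s (n≤1+n _) , s<2h

  to : (∀ s → h ≤ s → s < double h → g s ℚ.≤ g t) → t ≡ t₁ ⊎ t ≡ t₂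
  to t-max = Sum.map suc-injective suc-injective
    (only (suc∈ h≤t t<2h) (ℚ.≤-antisym (bounded (suc∈ h≤t t<2h)) M≤U[1+t]))
    where
    M≤U[1+t] : M ℚ.≤ U (suc t)
    M≤U[1+t] = subst (ℚ._≤ U (suc t)) attainedˡ (Equivalence.to (g-≤⇔U-≤ t₁ t) (t-max t₁ h≤t₁ t₁<2h))

  from : t ≡ t₁ ⊎ t ≡ t₂ → ∀ s → h ≤ s → s < double h → g s ℚ.≤ g t
  from t≡ s h≤s s<2h = Equivalence.from (g-≤⇔U-≤ s t) (ℚ.≤-trans (bounded (suc∈ h≤s s<2h)) (M≤ t≡))
    where
    M≤ : t ≡ t₁ ⊎ t ≡ t₂ → M ℚ.≤ U (suc t)
    M≤ (inj₁ refl) = ℚ.≤-reflexive (sym attainedˡ)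
    M≤ (inj₂ refl) = ℚ.≤-reflexive (sym attainedʳ)

ArgmaxG : ℕ → ℕ → ℕ → ℕ → Set
ArgmaxG lo hi t₁ t₂ =
  t₁ ≢ t₂ × t₁ < hi × t₂ < hi ×
  ((t : ℕ) → lo ≤ t → t < hi → ((∀ (s : ℕ) → lo ≤ s → s < hi → g s ≤ℚ g t) ⇔ (t ≡ t₁ ⊎ t ≡ t₂)))

ArgmaxG-cong : ∀ {lo lo′ hi hi′ t₁ t₁′ t₂ t₂′} → lo ≡ lo′ → hi ≡ hi′ → t₁ ≡ t₁′ → t₂ ≡ t₂′ →
               ArgmaxG lo hi t₁ t₂ → ArgmaxG lo′ hi′ t₁′ t₂′
ArgmaxG-cong refl refl refl refl argmax = argmax

argmax-block : ∀ j → half₁ j ≢ half₂ j →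
  ArgmaxG (pow2 (suc j)) (pow2 (suc (suc j))) (double (half₁ j)) (double (half₂ j))
argmax-block j half₁≢half₂ =
  half₁≢half₂ ∘ double-injective , proj₂ t₁∈ , proj₂ t₂∈ , g-argmax (proj₂ (maxOn-block j)) (proj₁ t₁∈) (proj₂ t₁∈)
  where
  double∈ : ∀ {a} → pow2 j ≤ a × a < pow2 (suc j) → pow2 (suc j) ≤ double a × double a < pow2 (suc (suc j))
  double∈ (lo , hi) = double-mono-≤ lo , ≤-trans (n≤1+n _) (double-mono-≤ hi)
  t₁∈ : pow2 (suc j) ≤ double (half₁ j) × double (half₁ j) < pow2 (suc (suc j))
  t₁∈ = double∈ (half₁-bounds j)
  t₂∈ : pow2 (suc j) ≤ double (half₂ j) × double (half₂ j) < pow2 (suc (suc j))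
  t₂∈ = double∈ (half₂-bounds j)

proposition10 : (m : ℕ) → 2 ≤ m →
  (2 ^ m + x (m / 2)) ≢ (2 ^ m + y ((m ∸ 1) / 2)) ×
  2 ^ m + x (m / 2) < 2 ^ (m + 1) ×
  2 ^ m + y ((m ∸ 1) / 2) < 2 ^ (m + 1) ×
  ((t : ℕ) → 2 ^ m ≤ t → t < 2 ^ (m + 1) →
    ((∀ (s : ℕ) → 2 ^ m ≤ s → s < 2 ^ (m + 1) → g s ≤ℚ g t)
      ⇔ (t ≡ 2 ^ m + x (m / 2) ⊎ t ≡ 2 ^ m + y ((m ∸ 1) / 2))))
proposition10 (suc zero) (s≤s ())
proposition10 (suc (suc i)) _ =
  ArgmaxG-cong (pow2≡2^ m) (trans (pow2≡2^ (suc m)) (cong (2 ^_) (ℕ.+-comm 1 m)))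
               (half₁-closed (suc i)) (half₂-closed (suc i))
               (argmax-block (suc i) (half₁≢half₂ i))
  where
  m : ℕ
  m = suc (suc i)
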